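{- Let $\mathbb{M}=\{\mu_1,\ldots,\mu_s\}$ be a finite set of guarded $x$-connectives, let $\mathcal{L}^\Theta_x(\mathbb{M})$ be the corresponding guarded $x$-fragment, and let $M_1,M_2$ be $\Theta$-models. If $A$ is an $(\mathcal{L}^\Theta_x(\mathbb{M}),M_1,M_2)$-asimulation and $\varphi(x)$ is logically equivalent to a formula in $\mathcal{L}^\Theta_x(\mathbb{M})$, then $\varphi(x)$ is invariant with respect to $A$.
   Context: Correspondence language: first-order logic without equality over the signature $\Sigma$ of binary letters $R_1,R_2,\ldots$ and unary letters $P_1,P_2,\ldots$; $\Theta\subseteq\Sigma$ contains all $R_i$; a $\Theta$-formula uses only letters in $\Theta$; a $\Theta$-model is a structure $M=\langle U,\iota\rangle$ for $\Theta$. Variables $x_1,x_2,\ldots$, $x:=x_1$; $M,a\models\varphi(x)$ means $\varphi$ holds when $x$ is assigned $a$. Guarded connectives: a $k$-ary guarded $x$-connective ($x$-g.c.) of degree $0$ is a Boolean combination of $P_1(x),\ldots,P_k(x)$ (neither $\forall$- nor $\exists$-guarded). If $\mu^-$ is a $k$-ary guarded $x_{m+1}$-connective of degree $n$ not $\forall$-guarded and $S_1,\ldots,S_m\in\{R_i\}$, then $\forall x_2\ldots x_{m+1}(\bigwedge_{i=1}^m S_i(x_i,x_{i+1})\to\mu^-)$ ($x_1=x$) is a $\forall$-guarded $x$-g.c. of degree $n+1$, provided it is not equivalent to an $x$-g.c. of smaller degree; dually for $\exists x_2\ldots x_{m+1}(\bigwedge S_i(x_i,x_{i+1})\wedge\mu^-)$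 when $\mu^-$ is not $\exists$-guarded. $\delta(\mu)$ is the degree, $\mu^-$ the immediate ancestor; the degree-$0$ ancestor $\mu^0$ defines the core function of $\mu$. Equivalent connectives are identified. $\mu(\psi_1,\ldots,\psi_k)$ replaces each $P_i(w)$ in $\mu$ by $\psi_i(w)$. The guarded $x$-fragment $\mathcal{L}^\Theta_x(\mathbb{M})$ is the least set of $\Theta$-formulas containing $P(x)$ for all unary $P\in\Theta$ and closed under applications of members of $\mathbb{M}$. Boolean functions (componentwise order, $0<1$): monotone, anti-monotone (constants are both), rest (neither); TFT: exist $\bar a<\bar b<\bar c$ with $f(\bar a)=f(\bar c)=1$, $f(\bar b)=0$; FTF: dually with values $0,1,0$. A degree-$1$ $x$-g.c. is special if it is $\forall$-guarded with rest non-TFT core function, or $\exists$-guarded with rest non-FTF core function. For $\Theta$-models $M_1,M_2$ with domains $U_1,U_2$, $W(M_1,M_2)$ is the set of relations $A\subseteq(U_1\times U_2)\cup(U_2\times U_1)$. $\varphi(x)$ is invariant w.r.t. $A$ if for all $\{r,t\}=\{1,2\}$, $a\in U_r,b\in U_t$: $aAb$ and $M_r,a\models\varphi$ imply $M_t,b\models\varphi$. For $\beta\subseteq W(M_1,M_2)$: $\beta^{ -1}=\{R^{ -1}:R\in\beta\}$, $\beta\cap\beta^{ -1}=\{R\cap R^{ -1}:R\in\beta\}$; $[f](\beta)$ is $W(M_1,M_2)$ if $f$ is constant, $\beta$ if non-constant monotone, $\beta^{ -1}$ if non-constant anti-monotone, $\beta\cap\beta^{ -1}$ otherwise. $[\mu](\beta)$,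 with $S^r_i=\iota_r(S_i)$: (i) $\delta(\mu)=0$: $[f](\beta)$, $f$ the core function. (ii) $\mu=\forall x_2\ldots x_{m+1}(\bigwedge S_i(x_i,x_{i+1})\to\mu^-)$ not special: tuples $\langle A_1,\ldots,A_{\delta(\mu)+1}\rangle$ with $\langle A_1,\ldots,A_{\delta(\mu)}\rangle\in[\mu^-](\beta)$ such that for all $\{r,t\}=\{1,2\}$, $a_1\in U_r$, $b_1,\ldots,b_{m+1}\in U_t$ with $a_1A_{\delta(\mu)+1}b_1$ and $S^t_i(b_i,b_{i+1})$ ($1\le i\le m$), there are $a_2,\ldots,a_{m+1}\in U_r$ with $S^r_i(a_i,a_{i+1})$ for all $i$ and $a_{m+1}A_{\delta(\mu)}b_{m+1}$. (iii) same form, special: pairs $\langle B,A\rangle$, $B\in\beta$, $A\in W(M_1,M_2)$, such that whenever $a_1Ab_1$, $a_1\in U_r$, $b_1,\ldots,b_{m+1}\in U_t$, $S^t_i(b_i,b_{i+1})$ for all $i$, there are $a_2,\ldots,a_{m+1}\in U_r$ with $S^r_i(a_i,a_{i+1})$ and $a_{m+1}Bb_{m+1}$, and $c_2,\ldots,c_{m+1}\in U_r$ with ($c_1=a_1$) $S^r_i(c_i,c_{i+1})$ and $b_{m+1}Bc_{m+1}$. (iv) $\mu=\exists x_2\ldots x_{m+1}(\bigwedge S_i(x_i,x_{i+1})\wedge\mu^-)$ not special: tuples with $\langle A_1,\ldots,A_{\delta(\mu)}\rangle\in[\mu^-](\beta)$ such that for all $\{r,t\}$, $a_1,\ldots,a_{m+1}\in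 U_r$, $b_1\in U_t$ with $a_1A_{\delta(\mu)+1}b_1$ and $S^r_i(a_i,a_{i+1})$ for all $i$, there are $b_2,\ldots,b_{m+1}\in U_t$ with $S^t_i(b_i,b_{i+1})$ and $a_{m+1}A_{\delta(\mu)}b_{m+1}$. (v) same form, special: pairs $\langle B,A\rangle$, $B\in\beta$, such that whenever $a_1Ab_1$ and $a_1,\ldots,a_{m+1}\in U_r$ with $S^r_i(a_i,a_{i+1})$ for all $i$, there are $b_2,\ldots,b_{m+1}\in U_t$ with $S^t_i(b_i,b_{i+1})$ and $a_{m+1}Bb_{m+1}$, and $c_2,\ldots,c_{m+1}\in U_t$ with ($c_1=b_1$) $S^t_i(c_i,c_{i+1})$ and $c_{m+1}Ba_{m+1}$. Asimulation: a non-empty $A\in W(M_1,M_2)$ w.r.t. which every $P(x)$ ($P\in\Theta$ unary) is invariant is an $(\mathcal{L}^\Theta_x(\mathbb{M}),M_1,M_2)$-asimulation if for each $1\le i\le s$ there exist $A_1,\ldots,A_{\delta(\mu_i)}$ with $\langle A_1,\ldots,A_{\delta(\mu_i)},A\rangle\in[\mu_i](\{A\})$. -}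

module Defs where

open import Level using (Level; 0ℓ; Lift) renaming (suc to lsuc)
open import Data.Nat using (ℕ; zero; suc; _<_)
open import Data.Fin using (Fin)
open import Data.Bool using (Bool; true; false) renaming (_≤_ to _≤ᵇ_)
open import Data.List using (List; []; _∷_)
open import Data.Vec using (Vec; []; _∷_; lookup)
open import Data.Vec.Relation.Binary.Pointwise.Inductive using (Pointwise)
open import Data.Product using (Σ; Σ-syntax; _×_; _,_)
open import Data.Sum using (_⊎_)
open import Data.Unit using (⊤)
open import Data.Empty using (⊥)
open import Relation.Nullary using (¬_)
open import Relation.Binary.PropositionalEquality using (_≡_; _≢_)
open import Function.Bundles using (_⇔_)

BoolFun : ℕ → Set
BoolFun k = Vec Bool k → Bool

_≤ᵛ_ : ∀ {k} → Vec Bool k → Vec Bool k → Set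
u ≤ᵛ v = Pointwise _≤ᵇ_ u v

_<ᵛ_ : ∀ {k} → Vec Bool k → Vec Bool k → Set
u <ᵛ v = u ≤ᵛ v × u ≢ v

Constant : ∀ {k} → BoolFun k → Set
Constant f = ∀ u v → f u ≡ f v

Monotone : ∀ {k} → BoolFun k → Set
Monotone f = ∀ u v → u ≤ᵛ v → f u ≤ᵇ f v

AntiMonotone : ∀ {k} → BoolFun k → Set
AntiMonotone f = ∀ u v → u ≤ᵛ v → f v ≤ᵇ f u

Rest : ∀ {k} → BoolFun k → Set
Rest f = ¬ Monotone f × ¬ AntiMonotone f

TFT : ∀ {k} → BoolFun k → Set
TFT f = Σ[ a ∈ _ ] Σ[ b ∈ _ ] Σ[ c ∈ _ ]
  (a <ᵛ b × b <ᵛ c × f a ≡ true × f b ≡ false × f c ≡ true)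

FTF : ∀ {k} → BoolFun k → Set
FTF f = Σ[ a ∈ _ ] Σ[ b ∈ _ ] Σ[ c ∈ _ ]
  (a <ᵛ b × b <ᵛ c × f a ≡ false × f b ≡ true × f c ≡ false)

-- Frames (interpretations of the binary letters R_1, R_2, ...; letter R_i
-- is indexed by i : ℕ) and S-labelled paths  S_1(x_1,x_2) ∧ ... ∧ S_m(x_m,x_{m+1})

record Frame : Set₁ where
  field
    U : Set
    R : ℕ → U → U → Set

data Path (F : Frame) : List ℕ → Frame.U F → Frame.U F → Set where
  []  : ∀ {a} → Path F [] a a
  _∷_ : ∀ {s ss a b c} → Frame.R F s a b → Path F ss b c → Path F (s ∷ ss) a c

-- (Pre-)guarded connectives, k-ary.  base f : Boolean combination of
-- P_1(x),...,P_k(x) with truth function f; all S μ / ex S μ :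
-- ∀x_2..x_{m+1}(⋀ S_i(x_i,x_{i+1}) → μ) / ∃x_2..x_{m+1}(⋀ S_i(x_i,x_{i+1}) ∧ μ)
-- where S = S_1 ... S_m (as indices of the binary letters).

data PreConn (k : ℕ) : Set where
  base : BoolFun k → PreConn k
  all  : List ℕ → PreConn k → PreConn k
  ex   : List ℕ → PreConn k → PreConn k

deg : ∀ {k} → PreConn k → ℕ
deg (base f)  = 0
deg (all _ μ) = suc (deg μ)
deg (ex _ μ)  = suc (deg μ)

⟦_⟧ᶜ : ∀ {k} → PreConn k → (F : Frame) → (Fin k → Frame.U F → Set) → Frame.U F → Set
⟦ base f ⟧ᶜ F ψ a = Σ[ v ∈ Vec Bool _ ] (f v ≡ true × (∀ i → (lookup v i ≡ true) ⇔ ψ i a))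
⟦ all S μ ⟧ᶜ F ψ a = ∀ b → Path F S a b → ⟦ μ ⟧ᶜ F ψ b
⟦ ex S μ ⟧ᶜ F ψ a = Σ[ b ∈ Frame.U F ] (Path F S a b × ⟦ μ ⟧ᶜ F ψ b)

EquivC : ∀ {k} → PreConn k → PreConn k → Set₁
EquivC ν μ = ∀ (F : Frame) (ψ : Fin _ → Frame.U F → Set) (a : Frame.U F) →
  ⟦ ν ⟧ᶜ F ψ a ⇔ ⟦ μ ⟧ᶜ F ψ a

IsAll : ∀ {k} → PreConn k → Set
IsAll (all _ _) = ⊤
IsAll _ = ⊥

IsEx : ∀ {k} → PreConn k → Set
IsEx (ex _ _) = ⊤
IsEx _ = ⊥

-- GC≤ n μ : μ is a guarded x-connective (of degree deg μ ≤ n)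
GC≤ : ∀ {k} → ℕ → PreConn k → Set₁
GC≤ n (base f) = Lift (lsuc 0ℓ) ⊤
GC≤ zero (all _ _) = Lift (lsuc 0ℓ) ⊥
GC≤ zero (ex _ _) = Lift (lsuc 0ℓ) ⊥
GC≤ (suc n) (all S μ) = GC≤ n μ × Lift (lsuc 0ℓ) (¬ IsAll μ) ×
  (∀ ν → GC≤ n ν → deg ν < deg (all S μ) → ¬ EquivC ν (all S μ))
GC≤ (suc n) (ex S μ) = GC≤ n μ × Lift (lsuc 0ℓ) (¬ IsEx μ) ×
  (∀ ν → GC≤ n ν → deg ν < deg (ex S μ) → ¬ EquivC ν (ex S μ))

IsGC : ∀ {k} → PreConn k → Set₁
IsGC μ = GC≤ (deg μ) μ

-- special-ness of a degree-1 connective, read off its immediate ancestor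
SpecialAll : ∀ {k} → PreConn k → Set
SpecialAll (base f) = Rest f × ¬ TFT f
SpecialAll _ = ⊥

SpecialEx : ∀ {k} → PreConn k → Set
SpecialEx (base f) = Rest f × ¬ FTF f
SpecialEx _ = ⊥

record ConnSet : Set₁ where
  field
    s     : ℕ
    arity : Fin s → ℕ
    conn  : (j : Fin s) → PreConn (arity j)
    isGC  : (j : Fin s) → IsGC (conn j)

-- Θ-models.  Θ is given by the set of unary letters it contains
-- (it contains all binary letters).

record Model (Θ : ℕ → Set) : Set₁ where
  field
    U : Set
    R : ℕ → U → U → Set
    P : (i : ℕ) → Θ i → U → Set

frame : ∀ {Θ} → Model Θ → Frame
frame M = record { U = Model.U M ; R = Model.R M }

data Form (Θ : ℕ → Set) (n : ℕ) : Set where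
  rel  : ℕ → Fin n → Fin n → Form Θ n
  pred : (i : ℕ) → Θ i → Fin n → Form Θ n
  ⊥'   : Form Θ n
  ¬'_  : Form Θ n → Form Θ n
  _∧'_ _∨'_ _⇒'_ : Form Θ n → Form Θ n → Form Θ n
  ∀' ∃' : Form Θ (suc n) → Form Θ n

⟦_⟧ᶠ : ∀ {Θ n} → Form Θ n → (M : Model Θ) → Vec (Model.U M) n → Set
⟦ rel i x y ⟧ᶠ M ρ = Model.R M i (lookup ρ x) (lookup ρ y)
⟦ pred i θ x ⟧ᶠ M ρ = Model.P M i θ (lookup ρ x)
⟦ ⊥' ⟧ᶠ M ρ = ⊥
⟦ ¬' φ ⟧ᶠ M ρ = ¬ ⟦ φ ⟧ᶠ M ρ
⟦ φ ∧' ψ ⟧ᶠ M ρ = ⟦ φ ⟧ᶠ M ρ × ⟦ ψ ⟧ᶠ M ρ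
⟦ φ ∨' ψ ⟧ᶠ M ρ = ⟦ φ ⟧ᶠ M ρ ⊎ ⟦ ψ ⟧ᶠ M ρ
⟦ φ ⇒' ψ ⟧ᶠ M ρ = ⟦ φ ⟧ᶠ M ρ → ⟦ ψ ⟧ᶠ M ρ
⟦ ∀' φ ⟧ᶠ M ρ = ∀ u → ⟦ φ ⟧ᶠ M (u ∷ ρ)
⟦ ∃' φ ⟧ᶠ M ρ = Σ[ u ∈ Model.U M ] ⟦ φ ⟧ᶠ M (u ∷ ρ)

_,_⊨_ : ∀ {Θ} (M : Model Θ) → Model.U M → Form Θ 1 → Set
M , a ⊨ φ = ⟦ φ ⟧ᶠ M (a ∷ [])

data Frag (Θ : ℕ → Set) (𝕄 : ConnSet) : Set where
  atom : (i : ℕ) → Θ i → Frag Θ 𝕄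
  app  : (j : Fin (ConnSet.s 𝕄)) → (Fin (ConnSet.arity 𝕄 j) → Frag Θ 𝕄) → Frag Θ 𝕄

⟦_⟧ᴸ : ∀ {Θ 𝕄} → Frag Θ 𝕄 → (M : Model Θ) → Model.U M → Set
⟦ atom i θ ⟧ᴸ M a = Model.P M i θ a
⟦_⟧ᴸ {𝕄 = 𝕄} (app j ψs) M a = ⟦ ConnSet.conn 𝕄 j ⟧ᶜ (frame M) (λ l → ⟦ ψs l ⟧ᴸ M) a

LogEquiv : ∀ {Θ 𝕄} → Form Θ 1 → Frag Θ 𝕄 → Set₁
LogEquiv φ ψ = ∀ M a → (M , a ⊨ φ) ⇔ ⟦ ψ ⟧ᴸ M a

data Side : Set where
  one two : Side

other : Side → Side
other one = two
other two = one

module Pair {Θ : ℕ → Set} (Ms : Side → Model Θ) where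

  U : Side → Set
  U r = Model.U (Ms r)

  Fr : Side → Frame
  Fr r = frame (Ms r)

  -- A ∈ W(M_1,M_2):  A r a b  means  a A b  for a ∈ U_r, b ∈ U_t (t = other r)
  W : Set₁
  W = (r : Side) → U r → U (other r) → Set

  back : W → (r : Side) → U (other r) → U r → Set
  back A one b a = A two b a
  back A two b a = A one b a

  _⁻¹ : W → W
  (A ⁻¹) r a b = back A r b a

  _∩_ : W → W → W
  (A ∩ B) r a b = A r a b × B r a b

  _≐_ : W → W → Set
  A ≐ B = ∀ r a b → A r a b ⇔ B r a b

  RelSet : Set₂
  RelSet = W → Set₁

  ｛_｝ : W → RelSet
  ｛ A ｝ Q = Lift (lsuc 0ℓ) (Q ≐ A)

  inv-set : RelSet → RelSet
  inv-set β Q = Σ[ R ∈ W ] (β R × Q ≐ (R ⁻¹))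

  meet-set : RelSet → RelSet
  meet-set β Q = Σ[ R ∈ W ] (β R × Q ≐ (R ∩ (R ⁻¹)))

  Core : ∀ {k} → BoolFun k → RelSet → RelSet
  Core f β A =
    Lift (lsuc 0ℓ) (Constant f)
    ⊎ (Lift (lsuc 0ℓ) (¬ Constant f × Monotone f) × β A)
    ⊎ (Lift (lsuc 0ℓ) (¬ Constant f × AntiMonotone f) × inv-set β A)
    ⊎ (Lift (lsuc 0ℓ) (¬ Constant f × Rest f) × meet-set β A)

  -- clause (ii):  B = A_δ, A = A_{δ+1}
  BackAll : List ℕ → W → W → Set
  BackAll S B A = ∀ r a₁ b₁ → A r a₁ b₁ → ∀ bₑ → Path (Fr (other r)) S b₁ bₑ →
    Σ[ aₑ ∈ U r ] (Path (Fr r) S a₁ aₑ × B r aₑ bₑ)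

  SpecAll : List ℕ → W → W → Set
  SpecAll S B A = ∀ r a₁ b₁ → A r a₁ b₁ → ∀ bₑ → Path (Fr (other r)) S b₁ bₑ →
    Σ[ aₑ ∈ U r ] (Path (Fr r) S a₁ aₑ × B r aₑ bₑ)
    × Σ[ cₑ ∈ U r ] (Path (Fr r) S a₁ cₑ × back B r bₑ cₑ)

  BackEx : List ℕ → W → W → Set
  BackEx S B A = ∀ r a₁ b₁ → A r a₁ b₁ → ∀ aₑ → Path (Fr r) S a₁ aₑ →
    Σ[ bₑ ∈ U (other r) ] (Path (Fr (other r)) S b₁ bₑ × B r aₑ bₑ)

  SpecEx : List ℕ → W → W → Set
  SpecEx S B A = ∀ r a₁ b₁ → A r a₁ b₁ → ∀ aₑ → Path (Fr r) S a₁ aₑ →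
    Σ[ bₑ ∈ U (other r) ] (Path (Fr (other r)) S b₁ bₑ × B r aₑ bₑ)
    × Σ[ cₑ ∈ U (other r) ] (Path (Fr (other r)) S b₁ cₑ × back B r cₑ aₑ)

  -- [μ](β) as a set of tuples ⟨A_1,...,A_{δ(μ)+1}⟩.  The tuple is stored
  -- REVERSED in the vector: head = A_{δ(μ)+1}, next = A_{δ(μ)}, ..., last = A_1.
  ⟦_⟧ʳ : ∀ {k} (μ : PreConn k) → RelSet → Vec W (suc (deg μ)) → Set₁
  ⟦ base f ⟧ʳ β (A ∷ []) = Core f β A
  ⟦ all S μ ⟧ʳ β (A ∷ B ∷ rest) =
    (Lift (lsuc 0ℓ) (SpecialAll μ) × β B × Lift (lsuc 0ℓ) (SpecAll S B A))
    ⊎ (Lift (lsuc 0ℓ) (¬ SpecialAll μ) × ⟦ μ ⟧ʳ β (B ∷ rest) × Lift (lsuc 0ℓ) (BackAll S B A))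
  ⟦ ex S μ ⟧ʳ β (A ∷ B ∷ rest) =
    (Lift (lsuc 0ℓ) (SpecialEx μ) × β B × Lift (lsuc 0ℓ) (SpecEx S B A))
    ⊎ (Lift (lsuc 0ℓ) (¬ SpecialEx μ) × ⟦ μ ⟧ʳ β (B ∷ rest) × Lift (lsuc 0ℓ) (BackEx S B A))

  Invariant : Form Θ 1 → W → Set
  Invariant φ A = ∀ r a b → A r a b → Ms r , a ⊨ φ → Ms (other r) , b ⊨ φ

  record IsAsimulation (𝕄 : ConnSet) (A : W) : Set₁ where
    field
      nonEmpty : Σ[ r ∈ Side ] Σ[ a ∈ U r ] Σ[ b ∈ U (other r) ] A r a b
      atomInv  : ∀ (i : ℕ) (θ : Θ i) r a b → A r a b →
                 Model.P (Ms r) i θ a → Model.P (Ms (other r)) i θ b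
      connCond : ∀ (j : Fin (ConnSet.s 𝕄)) →
                 Σ[ As ∈ Vec W (deg (ConnSet.conn 𝕄 j)) ]
                   ⟦ ConnSet.conn 𝕄 j ⟧ʳ ｛ A ｝ (A ∷ As)

-- Invariance is proved for every connective at once: if the arguments ψ_l are
-- invariant under every relation of β, then μ(ψ_1,...,ψ_k) is invariant under the
-- last component of any tuple of [μ](β).  At degree 0, deciding the ψ_l
-- classically turns satisfaction into the value of the core function on a truth
-- vector, and the relation shape [f](β) is chosen so that the truth vector moves
-- in the direction f respects.  An ∀/∃-step is the usual back-and-forth transfer
-- along guarded paths.  In the special degree-1 cases the two paths of (iii)/(v)
-- sandwich the truth vector at the target between two others, and non-TFT
-- (non-FTF) is exactly the convexity needed to conclude.  The corollary follows by
-- induction on fragment formulas, taking β = {A}.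
module Submission where

open import Defs
open import Level using (0ℓ; lift; lower) renaming (suc to lsuc)
open import Data.Nat using (ℕ)
open import Data.Fin using (Fin)
open import Data.List using (List)
open import Data.Bool using (Bool; true; false; b≤b; f≤t) renaming (_≤_ to _≤ᵇ_; _≟_ to _≟ᵇ_)
open import Data.Bool.Properties using (≤-antisym; ≤-maximum)
open import Data.Vec using (Vec; []; _∷_; lookup; tabulate; head)
open import Data.Vec.Properties using (lookup∘tabulate; tabulate∘lookup; tabulate-cong; ≡-dec)
open import Data.Vec.Relation.Binary.Pointwise.Inductive using (tabulate⁺)
open import Data.Product using (Σ-syntax; _×_; _,_; proj₁; proj₂)
open import Data.Sum using (_⊎_; inj₁; inj₂)
open import Data.Empty using (⊥-elim)
open import Relation.Nullary using (¬_; Dec; yes; no)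
open import Relation.Nullary.Decidable using (isYes; map′)
open import Relation.Binary.PropositionalEquality using (_≡_; refl; sym; trans; subst)
open import Function.Bundles using (_⇔_; mk⇔; Equivalence)
open import Axiom.ExcludedMiddle using (ExcludedMiddle)

open Equivalence using (to; from)

monotone-true : ∀ {k} {f : BoolFun k} {u v} → Monotone f → u ≤ᵛ v → f u ≡ true → f v ≡ true
monotone-true {f = f} {u} {v} mono u≤v fu =
  ≤-antisym (≤-maximum _) (subst (_≤ᵇ f v) fu (mono u v u≤v))

antiMonotone-true : ∀ {k} {f : BoolFun k} {u v} → AntiMonotone f → v ≤ᵛ u → f u ≡ true → f v ≡ true
antiMonotone-true {f = f} {u} {v} anti v≤u fu =
  ≤-antisym (≤-maximum _) (subst (_≤ᵇ f v) fu (anti v u v≤u))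

¬TFT⇒true-convex : ∀ {k} {f : BoolFun k} → ¬ TFT f → ∀ {u v w} → u ≤ᵛ v → v ≤ᵛ w →
                   f u ≡ true → f w ≡ true → f v ≡ true
¬TFT⇒true-convex {f = f} ¬tft {u} {v} {w} u≤v v≤w fu fw with f v in fv
... | true = refl
... | false with ≡-dec _≟ᵇ_ u v | ≡-dec _≟ᵇ_ v w
...   | yes refl | _        = trans (sym fv) fu
...   | no _     | yes refl = trans (sym fv) fw
...   | no u≢v   | no v≢w   = ⊥-elim (¬tft (u , v , w , (u≤v , u≢v) , (v≤w , v≢w) , fu , fv , fw))

¬FTF⇒true-below-or-above : ∀ {k} {f : BoolFun k} → ¬ FTF f → ∀ {u v w} → u ≤ᵛ v → v ≤ᵛ w →
                           f v ≡ true → f u ≡ true ⊎ f w ≡ true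
¬FTF⇒true-below-or-above {f = f} ¬ftf {u} {v} {w} u≤v v≤w fv with f u in fu | f w in fw
... | true  | _    = inj₁ refl
... | false | true = inj₂ refl
... | false | false with ≡-dec _≟ᵇ_ u v | ≡-dec _≟ᵇ_ v w
...   | yes refl | _        = inj₁ (trans (sym fu) fv)
...   | no _     | yes refl = inj₂ (trans (sym fw) fv)
...   | no u≢v   | no v≢w   = ⊥-elim (¬ftf (u , v , w , (u≤v , u≢v) , (v≤w , v≢w) , fu , fv , fw))

isYes-mono : ∀ {P Q : Set} → (P → Q) → (d : Dec P) (e : Dec Q) → isYes d ≤ᵇ isYes e
isYes-mono P⇒Q (yes p) (yes _) = b≤b
isYes-mono P⇒Q (yes p) (no ¬q) = ⊥-elim (¬q (P⇒Q p))
isYes-mono P⇒Q (no _)  (yes _) = f≤t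
isYes-mono P⇒Q (no _)  (no _)  = b≤b

isYes⇔ : ∀ {P : Set} (d : Dec P) → (isYes d ≡ true) ⇔ P
isYes⇔ (yes p) = mk⇔ (λ _ → p) (λ _ → refl)
isYes⇔ (no ¬p) = mk⇔ (λ ()) (λ p → ⊥-elim (¬p p))

isYes-unique : ∀ {P : Set} {b} → (b ≡ true) ⇔ P → (d : Dec P) → b ≡ isYes d
isYes-unique {b = true}  b⇔P (yes _) = refl
isYes-unique {b = true}  b⇔P (no ¬p) = ⊥-elim (¬p (to b⇔P refl))
isYes-unique {b = false} b⇔P (yes p) = from b⇔P p
isYes-unique {b = false} b⇔P (no _)  = refl

base-cong : ∀ {k} {f : BoolFun k} {F G : Frame} {ψ χ a b} →
            (∀ i → ψ i a ⇔ χ i b) → ⟦ base f ⟧ᶜ F ψ a → ⟦ base f ⟧ᶜ G χ b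
base-cong ψ⇔χ (v , fv , v⇔ψ) = v , fv , λ i →
  mk⇔ (λ vi → to (ψ⇔χ i) (to (v⇔ψ i) vi)) (λ χi → from (v⇔ψ i) (from (ψ⇔χ i) χi))

module _ (em : ExcludedMiddle (lsuc 0ℓ)) where

  decide : (P : Set) → Dec P
  decide P = map′ lower lift em

  truthVector : ∀ {k} → (Fin k → Set) → Vec Bool k
  truthVector P = tabulate (λ i → isYes (decide (P i)))

  truthVector-mono : ∀ {k} {P Q : Fin k → Set} → (∀ i → P i → Q i) →
                     truthVector P ≤ᵛ truthVector Q
  truthVector-mono P⇒Q = tabulate⁺ (λ i → isYes-mono (P⇒Q i) (decide _) (decide _))

  lookup-truthVector : ∀ {k} (P : Fin k → Set) i → (lookup (truthVector P) i ≡ true) ⇔ P i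
  lookup-truthVector P i = mk⇔
    (λ t → to (isYes⇔ (decide (P i))) (trans (sym (lookup∘tabulate _ i)) t))
    (λ p → trans (lookup∘tabulate _ i) (from (isYes⇔ (decide (P i))) p))

  base⇔truthVector : ∀ {k} {f : BoolFun k} {F ψ a} →
                     ⟦ base f ⟧ᶜ F ψ a ⇔ (f (truthVector (λ i → ψ i a)) ≡ true)
  base⇔truthVector {f = f} = mk⇔
    (λ { (v , fv , v⇔ψ) → subst (λ w → f w ≡ true) (v≡truthVector v⇔ψ) fv })
    (λ fv → truthVector _ , fv , lookup-truthVector _)
    where
    v≡truthVector : ∀ {k} {v : Vec Bool k} {P} → (∀ i → (lookup v i ≡ true) ⇔ P i) → v ≡ truthVector P
    v≡truthVector {v = v} v⇔P =
      trans (sym (tabulate∘lookup v)) (tabulate-cong (λ i → isYes-unique (v⇔P i) (decide _)))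

module _ {Θ : ℕ → Set} (Ms : Side → Model Θ) where
  open Pair Ms

  Pred : Set₁
  Pred = (r : Side) → U r → Set

  PredInvariant : Pred → W → Set
  PredInvariant P R = ∀ r a b → R r a b → P r a → P (other r) b

  PredInvariant-back : ∀ {P R} → PredInvariant P R → ∀ r a b → back R r b a → P (other r) b → P r a
  PredInvariant-back inv one a b = inv two b a
  PredInvariant-back inv two a b = inv one b a

  PredInvariant-≐ : ∀ {P Q R} → Q ≐ R → PredInvariant P R → PredInvariant P Q
  PredInvariant-≐ Q≐R inv r a b Qab = inv r a b (to (Q≐R r a b) Qab)

  □ ◇ : List ℕ → Pred → Pred
  □ S P r a = ∀ c → Path (Fr r) S a c → P r c
  ◇ S P r a = Σ[ c ∈ U r ] (Path (Fr r) S a c × P r c)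

  BackAll⇒□-invariant : ∀ {S B A P} → BackAll S B A → PredInvariant P B → PredInvariant (□ S P) A
  BackAll⇒□-invariant transfer inv r a b Aab □Pa c b⇝c with transfer r a b Aab c b⇝c
  ... | a′ , a⇝a′ , Ba′c = inv r a′ c Ba′c (□Pa a′ a⇝a′)

  BackEx⇒◇-invariant : ∀ {S B A P} → BackEx S B A → PredInvariant P B → PredInvariant (◇ S P) A
  BackEx⇒◇-invariant transfer inv r a b Aab (a′ , a⇝a′ , Pa′) with transfer r a b Aab a′ a⇝a′
  ... | b′ , b⇝b′ , Ba′b′ = b′ , b⇝b′ , inv r a′ b′ Ba′b′ Pa′

  Preds : ℕ → Set₁
  Preds k = (r : Side) → Fin k → U r → Set

  FamilyInvariant : ∀ {k} → Preds k → W → Set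
  FamilyInvariant ψ R = ∀ l → PredInvariant (λ r → ψ r l) R

  InvariantUnder : ∀ {k} → RelSet → Preds k → Set₁
  InvariantUnder β ψ = ∀ R → β R → FamilyInvariant ψ R

  InvariantUnder-｛｝ : ∀ {k A} {ψ : Preds k} → FamilyInvariant ψ A → InvariantUnder ｛ A ｝ ψ
  InvariantUnder-｛｝ inv R (lift R≐A) l = PredInvariant-≐ R≐A (inv l)

  Sat : ∀ {k} → PreConn k → Preds k → Pred
  Sat μ ψ r = ⟦ μ ⟧ᶜ (Fr r) (ψ r)

  module _ (em : ExcludedMiddle (lsuc 0ℓ)) where

    Sat-base⇔ : ∀ {k} {f : BoolFun k} (ψ : Preds k) r a →
                Sat (base f) ψ r a ⇔ (f (truthVector em (λ l → ψ r l a)) ≡ true)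
    Sat-base⇔ ψ r a = base⇔truthVector em {F = Fr r} {ψ = ψ r} {a = a}

    Core⇒base-invariant : ∀ {k β A} {f : BoolFun k} {ψ} → InvariantUnder β ψ →
                          Core f β A → PredInvariant (Sat (base f) ψ) A
    Core⇒base-invariant {ψ = ψ} inv (inj₁ (lift const)) r a b _ fa =
      from (Sat-base⇔ ψ (other r) b) (trans (const _ _) (to (Sat-base⇔ ψ r a) fa))
    Core⇒base-invariant {A = A} {ψ = ψ} inv (inj₂ (inj₁ (lift (_ , mono) , βA))) r a b Aab fa =
      from (Sat-base⇔ ψ (other r) b)
        (monotone-true mono (truthVector-mono em (λ l → inv A βA l r a b Aab))
          (to (Sat-base⇔ ψ r a) fa))
    Core⇒base-invariant {ψ = ψ} inv (inj₂ (inj₂ (inj₁ (lift (_ , anti) , R , βR , A≐R⁻¹)))) r a b Aab fa =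
      from (Sat-base⇔ ψ (other r) b)
        (antiMonotone-true anti
          (truthVector-mono em (λ l → PredInvariant-back (inv R βR l) r a b (to (A≐R⁻¹ r a b) Aab)))
          (to (Sat-base⇔ ψ r a) fa))
    Core⇒base-invariant {ψ = ψ} inv (inj₂ (inj₂ (inj₂ (_ , R , βR , A≐R∩R⁻¹)))) r a b Aab =
      base-cong {F = Fr r} {G = Fr (other r)} {ψ = ψ r} {χ = ψ (other r)} λ l →
        mk⇔ (inv R βR l r a b (proj₁ R∩R⁻¹ab)) (PredInvariant-back (inv R βR l) r a b (proj₂ R∩R⁻¹ab))
      where R∩R⁻¹ab = to (A≐R∩R⁻¹ r a b) Aab

    SpecAll⇒□-invariant : ∀ {k S B A} {f : BoolFun k} {ψ} → ¬ TFT f → FamilyInvariant ψ B →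
                          SpecAll S B A → PredInvariant (Sat (all S (base f)) ψ) A
    SpecAll⇒□-invariant {ψ = ψ} ¬tft inv spec r a b Aab □fa c b⇝c with spec r a b Aab c b⇝c
    ... | a′ , (a⇝a′ , Ba′c) , a″ , a⇝a″ , Bca″ =
      from (Sat-base⇔ ψ (other r) c)
        (¬TFT⇒true-convex ¬tft
          (truthVector-mono em (λ l → inv l r a′ c Ba′c))
          (truthVector-mono em (λ l → PredInvariant-back (inv l) r a″ c Bca″))
          (to (Sat-base⇔ ψ r a′) (□fa a′ a⇝a′))
          (to (Sat-base⇔ ψ r a″) (□fa a″ a⇝a″)))

    SpecEx⇒◇-invariant : ∀ {k S B A} {f : BoolFun k} {ψ} → ¬ FTF f → FamilyInvariant ψ B →
                         SpecEx S B A → PredInvariant (Sat (ex S (base f)) ψ) A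
    SpecEx⇒◇-invariant {ψ = ψ} ¬ftf inv spec r a b Aab (a′ , a⇝a′ , fa′) with spec r a b Aab a′ a⇝a′
    ... | b′ , (b⇝b′ , Ba′b′) , b″ , b⇝b″ , Bb″a′
      with ¬FTF⇒true-below-or-above ¬ftf
             (truthVector-mono em (λ l → PredInvariant-back (inv l) r a′ b″ Bb″a′))
             (truthVector-mono em (λ l → inv l r a′ b′ Ba′b′))
             (to (Sat-base⇔ ψ r a′) fa′)
    ...   | inj₁ fb″ = b″ , b⇝b″ , from (Sat-base⇔ ψ (other r) b″) fb″
    ...   | inj₂ fb′ = b′ , b⇝b′ , from (Sat-base⇔ ψ (other r) b′) fb′

    ⟦⟧ʳ-invariant : ∀ {k β} (μ : PreConn k) {ψ : Preds k} → InvariantUnder β ψ →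
                    ∀ As → ⟦ μ ⟧ʳ β As → PredInvariant (Sat μ ψ) (head As)
    ⟦⟧ʳ-invariant (base f) inv (_ ∷ []) core = Core⇒base-invariant inv core
    ⟦⟧ʳ-invariant (all S (base f)) inv (_ ∷ B ∷ []) (inj₁ (lift (_ , ¬tft) , βB , lift spec)) =
      SpecAll⇒□-invariant ¬tft (inv B βB) spec
    ⟦⟧ʳ-invariant (ex S (base f)) inv (_ ∷ B ∷ []) (inj₁ (lift (_ , ¬ftf) , βB , lift spec)) =
      SpecEx⇒◇-invariant ¬ftf (inv B βB) spec
    ⟦⟧ʳ-invariant (all S μ) inv (_ ∷ Bs@(_ ∷ _)) (inj₂ (_ , μBs , lift transfer)) =
      BackAll⇒□-invariant transfer (⟦⟧ʳ-invariant μ inv Bs μBs)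
    ⟦⟧ʳ-invariant (ex S μ) inv (_ ∷ Bs@(_ ∷ _)) (inj₂ (_ , μBs , lift transfer)) =
      BackEx⇒◇-invariant transfer (⟦⟧ʳ-invariant μ inv Bs μBs)

    Frag-invariant : ∀ {𝕄 A} → IsAsimulation 𝕄 A → (ψ : Frag Θ 𝕄) →
                     PredInvariant (λ r → ⟦ ψ ⟧ᴸ (Ms r)) A
    Frag-invariant asim (atom i θ) = IsAsimulation.atomInv asim i θ
    Frag-invariant {𝕄} {A} asim (app j ψs) with IsAsimulation.connCond asim j
    ... | As , μAs = ⟦⟧ʳ-invariant (ConnSet.conn 𝕄 j)
                       (InvariantUnder-｛｝ (λ l → Frag-invariant asim (ψs l))) (A ∷ As) μAs

corollary1 : ExcludedMiddle (lsuc 0ℓ) →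
    (Θ : ℕ → Set) (𝕄 : ConnSet) (Ms : Side → Model Θ) (A : Pair.W Ms) →
    Pair.IsAsimulation Ms 𝕄 A →
    (φ : Form Θ 1) → Σ[ ψ ∈ Frag Θ 𝕄 ] LogEquiv φ ψ →
    Pair.Invariant Ms φ A
corollary1 em Θ 𝕄 Ms A asim φ (ψ , φ⇔ψ) r a b Aab a⊨φ =
  from (φ⇔ψ (Ms (other r)) b) (Frag-invariant Ms em asim ψ r a b Aab (to (φ⇔ψ (Ms r) a) a⊨φ))
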